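{- Let $k\geq2$, let $n\leq r<\frac{(k-1)(2n)}{k}$, and let $\mathcal{F}\subseteq\mathcal{H}^r(M_n)$ be $k$-wise intersecting. Let $\sigma$ be a good cyclic ordering that is saturated and such that every set in $\mathcal{F}_\sigma$ contains $\sigma(2n)$. Let $i\in[n-2]$ and let $\mu$ be the good cyclic ordering obtained from $\sigma$ by swapping the entries in positions $i$ and $i+1$ and also the entries in positions $i+n$ and $i+n+1$. If $\mu$ is saturated, then every set in $\mathcal{F}_\mu$ contains $\mu(2n)$ $(=\sigma(2n))$.
   Context: $M_n$ is the perfect matching on vertex set $[2n]=\{1,\dots,2n\}$ with edges $\{i,n+i\}$, $1\le i\le n$; the two endpoints of an edge are partners. $\mathcal{H}^r(M_n)$ is the family of $r$-subsets of $[2n]$ that are either independent in $M_n$ or contain a maximum independent set of $M_n$. A family is $k$-wise intersecting if any $k$ members have a common element. A good cyclic ordering is a bijection $\sigma:[2n]\to[2n]$ (where $\sigma(p)$ is the vertex at position $p$, positions taken mod $2n$) such that for each $p\in[n]$, $\sigma(p)$ and $\sigma(p+n)$ are partners. A $\sigma$-interval of length $r$ is a set $\{\sigma(p),\sigma(p+1),\dots,\sigma(p+r-1)\}$ (positions mod $2n$). $\mathcal{F}_\sigma$ is the set of members of $\mathcal{F}$ that are $\sigma$-intervals, and $\sigma$ is saturated if $|\mathcal{F}_\sigma|=r$. -}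

module Defs where

open import Data.Nat using (ℕ; zero; suc; _+_; _*_; _<_)
open import Data.Fin using (Fin; toℕ)
open import Data.Fin.Subset using (Subset; _∈_; ∣_∣)
open import Data.Fin.Permutation using (Permutation′; _⟨$⟩ʳ_; transpose; _∘ₚ_)
open import Data.List using (List; length)
open import Data.List.Relation.Unary.All using (All)
open import Data.List.Relation.Unary.Unique.Propositional using (Unique)
import Data.List.Membership.Propositional as LM
open import Data.Product using (Σ; ∃; _×_)
open import Data.Sum using (_⊎_)
open import Relation.Binary.PropositionalEquality using (_≡_)
open import Data.Empty using (⊥)

-- Conventions (0-indexed): the vertex set [2n] is Fin (n + n); vertex v (0-indexed)
-- corresponds to vertex v+1 of the paper.  Edges of M_n are {v , n + v} for v < n.

Partners : (n : ℕ) → Fin (n + n) → Fin (n + n) → Set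
Partners n u v = (toℕ v ≡ n + toℕ u) ⊎ (toℕ u ≡ n + toℕ v)

Independent : (n : ℕ) → Subset (n + n) → Set
Independent n S = ∀ u v → Partners n u v → u ∈ S → v ∈ S → ⊥

-- I is a maximum independent set of M_n: independent and meets every edge
-- (so it contains exactly one endpoint of each of the n edges, |I| = n)
MaxIndependent : (n : ℕ) → Subset (n + n) → Set
MaxIndependent n I = Independent n I × (∀ u v → Partners n u v → (u ∈ I) ⊎ (v ∈ I))

_⊆ˢ_ : ∀ {m} → Subset m → Subset m → Set
A ⊆ˢ B = ∀ x → x ∈ A → x ∈ B

InH : (n r : ℕ) → Subset (n + n) → Set
InH n r S = (∣ S ∣ ≡ r) × (Independent n S ⊎ (Σ (Subset (n + n)) λ I → MaxIndependent n I × (I ⊆ˢ S)))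

Family : ℕ → Set₁
Family m = Subset m → Set

FamilyInH : (n r : ℕ) → Family (n + n) → Set
FamilyInH n r F = ∀ S → F S → InH n r S

KWiseIntersecting : ∀ {m} → ℕ → Family m → Set
KWiseIntersecting {m} k F =
  (A : Fin k → Subset m) → (∀ j → F (A j)) → ∃ λ (x : Fin m) → ∀ j → x ∈ A j

-- Cyclic orderings: σ ⟨$⟩ʳ p is the vertex at position p (positions 0-indexed, mod 2n).
-- Good: for each position p < n, σ(p) and σ(p + n) are partners.
Good : (n : ℕ) → Permutation′ (n + n) → Set
Good n σ = ∀ (p q : Fin (n + n)) → toℕ p < n → toℕ q ≡ toℕ p + n →
           Partners n (σ ⟨$⟩ʳ p) (σ ⟨$⟩ʳ q)

_≡ₘ_ : ∀ {m} → Fin m → ℕ → Set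
_≡ₘ_ {m} q a = ∃ λ t → a ≡ t * m + toℕ q

IsIntervalAt : ∀ {m} → Permutation′ m → ℕ → Fin m → Subset m → Set
IsIntervalAt {m} σ r p S =
  ∀ x → (x ∈ S → ∃ λ j → j < r × ∃ λ (q : Fin m) → q ≡ₘ (toℕ p + j) × x ≡ σ ⟨$⟩ʳ q)
      × ((∃ λ j → j < r × ∃ λ (q : Fin m) → q ≡ₘ (toℕ p + j) × x ≡ σ ⟨$⟩ʳ q) → x ∈ S)

IsInterval : ∀ {m} → Permutation′ m → ℕ → Subset m → Set
IsInterval {m} σ r S = ∃ λ (p : Fin m) → IsIntervalAt σ r p S

Fσ : ∀ {m} → Family m → Permutation′ m → ℕ → Family m
Fσ F σ r S = F S × IsInterval σ r S

HasCard : ∀ {m} → Family m → ℕ → Set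
HasCard {m} X c = Σ (List (Subset m)) λ L →
  Unique L × length L ≡ c × All X L × (∀ S → X S → S LM.∈ L)

Saturated : ∀ {m} → Family m → ℕ → Permutation′ m → Set
Saturated F r σ = HasCard (Fσ F σ r) r

-- the last position 2n (0-indexed: 2n - 1)
IsLastPos : ∀ {m} → Fin m → Set
IsLastPos {m} q = suc (toℕ q) ≡ m

AllContainLast : ∀ {m} → Family m → ℕ → Permutation′ m → Set
AllContainLast {m} F r σ =
  ∀ S → Fσ F σ r S → ∀ (q : Fin m) → IsLastPos q → (σ ⟨$⟩ʳ q) ∈ S

-- μ obtained from σ by swapping the entries at positions a, b and at positions c, d:
-- μ(q) = σ(τ(q)) where τ = transposition (a b) then (c d)
swapOrdering : ∀ {m} → Permutation′ m → (a b c d : Fin m) → Permutation′ m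
swapOrdering σ a b c d = (transpose a b ∘ₚ transpose c d) ∘ₚ σ

-- Suppose some T ∈ F_μ misses μ(2n). Then T is a μ-interval [p, p + r) that does not wrap around,
-- and as μ differs from σ by two adjacent transpositions, the σ-positions of T lie in a window
-- [lo, hi) of length at most r + 1, or r + 2 when r = n. Saturation and the hypothesis on σ force
-- all r σ-intervals through the last position into F; with L = 2n - r, the one starting at c + L
-- misses exactly the positions [c, c + L). Since r < (k - 1) L, k - 1 of these gaps cover the
-- window, so those k - 1 intervals together with T have no common element.

module Submission where

open import Defs
open import Data.Nat
open import Data.Nat.Properties
open import Data.Nat.DivMod using (_/_; _%_; m≡m%n+[m/n]*n; m%n<n; m/n*n≤m; m<n*o⇒m/o<n)
open import Data.Fin as Fin using (Fin; toℕ; fromℕ<; punchOut)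
open import Data.Fin.Properties using (toℕ-injective; toℕ-fromℕ<; toℕ<n; punchOut-injective; injective⇒≤; any?)
open import Data.Fin.Subset using (Subset; _∈_)
open import Data.Fin.Subset.Properties using (⊆-antisym; _∈?_)
open import Data.Fin.Permutation using (Permutation′; _⟨$⟩ʳ_; _⟨$⟩ˡ_; inverseˡ; inverseʳ)
import Data.Fin.Permutation.Components as PC
open import Data.List using (List; length; lookup)
import Data.List.Relation.Unary.All as All
open import Data.List.Relation.Unary.AllPairs using (_∷_)
open import Data.List.Relation.Unary.Unique.Propositional using (Unique)
open import Data.List.Membership.Propositional.Properties using (∈-lookup)
open import Data.Product using (∃; _×_; _,_; proj₁; proj₂)
open import Data.Sum using (_⊎_; inj₁; inj₂)
open import Data.Empty using (⊥; ⊥-elim)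
open import Function.Definitions using (Injective)
open import Relation.Nullary using (¬_; Dec; yes; no; contradiction)
open import Relation.Nullary.Decidable using (_⊎-dec_)
open import Level using (0ℓ)
open import Relation.Unary using (Pred; _∪_; _⊆_)
open import Relation.Binary.PropositionalEquality
open import Algebra.Properties.CommutativeSemigroup +-commutativeSemigroup using (xy∙z≈xz∙y)

lookup-injective : ∀ {A : Set} {xs : List A} → Unique xs → Injective _≡_ _≡_ (lookup xs)
lookup-injective (_ ∷ _)     {Fin.zero}  {Fin.zero}  _  = refl
lookup-injective (x∉ ∷ _)    {Fin.zero}  {Fin.suc j} eq = contradiction eq (All.lookup x∉ (∈-lookup j))
lookup-injective (x∉ ∷ _)    {Fin.suc i} {Fin.zero}  eq = contradiction (sym eq) (All.lookup x∉ (∈-lookup i))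
lookup-injective (_ ∷ uniq)  {Fin.suc i} {Fin.suc j} eq = cong Fin.suc (lookup-injective uniq eq)

-- A missed value would let punchOut inject Fin m into Fin (n ∸ 1).
injective⇒surjective : ∀ {m n} {f : Fin m → Fin n} → n ≤ m → Injective _≡_ _≡_ f →
                       ∀ y → ∃ λ x → f x ≡ y
injective⇒surjective {m} {suc n′} {f} n≤m f-inj y with any? (λ x → f x Fin.≟ y)
... | yes hit = hit
... | no miss = ⊥-elim (<⇒≱ n≤m (injective⇒≤ g-inj))
  where
  y≢f : ∀ x → y ≢ f x
  y≢f x eq = miss (x , sym eq)
  g : Fin m → Fin n′
  g x = punchOut (y≢f x)
  g-inj : Injective _≡_ _≡_ g
  g-inj eq = f-inj (punchOut-injective (y≢f _) (y≢f _) eq)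

position : ∀ {m} → Permutation′ m → Fin m → ℕ
position σ x = toℕ (σ ⟨$⟩ˡ x)

position-⟨$⟩ʳ : ∀ {m} (σ : Permutation′ m) q → position σ (σ ⟨$⟩ʳ q) ≡ toℕ q
position-⟨$⟩ʳ σ q = cong toℕ (inverseˡ σ)

IsIntervalAt-unique : ∀ {m} (σ : Permutation′ m) {r p S S′} →
                      IsIntervalAt σ r p S → IsIntervalAt σ r p S′ → S ≡ S′
IsIntervalAt-unique σ at at′ =
  ⊆-antisym (λ x∈S  → proj₂ (at′ _) (proj₁ (at _) x∈S))
            (λ x∈S′ → proj₂ (at _) (proj₁ (at′ _) x∈S′))

∈-interval⇒position : ∀ {m} (σ : Permutation′ m) {r p S x} → r ≤ m → IsIntervalAt σ r p S → x ∈ S →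
  ∃ λ j → j < r × (position σ x ≡ toℕ p + j ⊎ position σ x + m ≡ toℕ p + j)
∈-interval⇒position {m} σ {r} {p} r≤m at x∈S with proj₁ (at _) x∈S
... | j , j<r , q , (t , p+j≡) , refl rewrite position-⟨$⟩ʳ σ q = j , j<r , unwrap t p+j≡
  where
  p+j<m+m : toℕ p + j < m + m
  p+j<m+m = +-mono-< (toℕ<n p) (<-≤-trans j<r r≤m)
  unwrap : ∀ t → toℕ p + j ≡ t * m + toℕ q → toℕ q ≡ toℕ p + j ⊎ toℕ q + m ≡ toℕ p + j
  unwrap 0 eq = inj₁ (sym eq)
  unwrap 1 eq = inj₂ (sym (trans eq (trans (cong (_+ toℕ q) (*-identityˡ m)) (+-comm m (toℕ q)))))
  unwrap (suc (suc t)) eq = contradiction eq (<⇒≢ (<-≤-trans p+j<m+m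
    (≤-trans (+-monoʳ-≤ m (m≤m+n m (t * m))) (m≤m+n _ (toℕ q)))))

last∈interval⇒m≤start+r : ∀ {m} (σ : Permutation′ m) {r p S q} → r ≤ m → IsLastPos q →
                          IsIntervalAt σ r p S → σ ⟨$⟩ʳ q ∈ S → m ≤ toℕ p + r
last∈interval⇒m≤start+r {m} σ {r} {p} {q = q} r≤m last at q∈S
  with ∈-interval⇒position σ r≤m at q∈S
... | j , j<r , inj₁ q≡p+j = begin
  m               ≡⟨ sym last ⟩
  suc (toℕ q)     ≡⟨ cong suc (trans (sym (position-⟨$⟩ʳ σ q)) q≡p+j) ⟩
  suc (toℕ p + j) ≤⟨ +-monoʳ-< (toℕ p) j<r ⟩
  toℕ p + r       ∎
  where open ≤-Reasoning
... | j , j<r , inj₂ q+m≡p+j =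
  contradiction (trans (sym q+m≡p+j) (cong (_+ m) (position-⟨$⟩ʳ σ q))) (<⇒≢ p+j<q+m)
  where
  p≤q : toℕ p ≤ toℕ q
  p≤q = s≤s⁻¹ (subst (toℕ p <_) (sym last) (toℕ<n p))
  p+j<q+m : toℕ p + j < toℕ q + m
  p+j<q+m = +-mono-≤-< p≤q (<-≤-trans j<r r≤m)

m≤start+r⇒last∈interval : ∀ {m} (σ : Permutation′ m) {r p S q} → IsLastPos q → m ≤ toℕ p + r →
                          IsIntervalAt σ r p S → σ ⟨$⟩ʳ q ∈ S
m≤start+r⇒last∈interval σ {p = p} {q = q} last m≤p+r at =
  proj₂ (at _) (toℕ q ∸ toℕ p , j<r , q , (0 , p+j≡q) , refl)
  where
  p+j≡q : toℕ p + (toℕ q ∸ toℕ p) ≡ toℕ q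
  p+j≡q = m+[n∸m]≡n (s≤s⁻¹ (subst (toℕ p <_) (sym last) (toℕ<n p)))
  j<r : toℕ q ∸ toℕ p < _
  j<r = +-cancelˡ-< (toℕ p) _ _ (subst (_≤ toℕ p + _) (sym (trans (cong suc p+j≡q) last)) m≤p+r)

last∉interval⇒start+r<m : ∀ {m} (σ : Permutation′ m) {r p S q} → IsLastPos q →
                          IsIntervalAt σ r p S → ¬ σ ⟨$⟩ʳ q ∈ S → toℕ p + r < m
last∉interval⇒start+r<m {m} σ {r = r} {p = p} last at q∉S with toℕ p + r <? m
... | yes p+r<m = p+r<m
... | no  p+r≮m = contradiction (m≤start+r⇒last∈interval σ last (≮⇒≥ p+r≮m) at) q∉S

non-wrapping-interval⇒position : ∀ {m} (σ : Permutation′ m) {r p S x} → toℕ p + r ≤ m →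
  IsIntervalAt σ r p S → x ∈ S → toℕ p ≤ position σ x × position σ x < toℕ p + r
non-wrapping-interval⇒position {m} σ {r} {p} {x = x} p+r≤m at x∈S
  with ∈-interval⇒position σ (≤-trans (m≤n+m r (toℕ p)) p+r≤m) at x∈S
... | j , j<r , inj₁ x≡p+j = subst (toℕ p ≤_) (sym x≡p+j) (m≤m+n (toℕ p) j) ,
                             subst (_< toℕ p + r) (sym x≡p+j) (+-monoʳ-< (toℕ p) j<r)
... | j , j<r , inj₂ x+m≡p+j = contradiction x+m≡p+j (>⇒≢ (begin-strict
  toℕ p + j          <⟨ +-monoʳ-< (toℕ p) j<r ⟩
  toℕ p + r          ≤⟨ p+r≤m ⟩
  m                  ≤⟨ m≤n+m m (position σ x) ⟩
  position σ x + m   ∎))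
  where open ≤-Reasoning

wrapping-interval⇒position : ∀ {m} (σ : Permutation′ m) {r L c p S x} → r + L ≡ m → toℕ p ≡ c + L →
  IsIntervalAt σ r p S → x ∈ S → position σ x < c ⊎ c + L ≤ position σ x
wrapping-interval⇒position {m} σ {r} {L} {c} {p} {x = x} r+L≡m p≡c+L at x∈S
  with ∈-interval⇒position σ (subst (r ≤_) r+L≡m (m≤m+n r L)) at x∈S
... | j , j<r , inj₁ x≡p+j = inj₂ (subst (c + L ≤_) (sym (trans x≡p+j (cong (_+ j) p≡c+L))) (m≤m+n (c + L) j))
... | j , j<r , inj₂ x+m≡p+j = inj₁ (+-cancelʳ-< r (position σ x) c (begin-strict
  position σ x + r   ≡⟨ +-cancelʳ-≡ L _ _ x+r+L≡c+j+L ⟩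
  c + j              <⟨ +-monoʳ-< c j<r ⟩
  c + r              ∎))
  where
  open ≤-Reasoning
  x+r+L≡c+j+L : position σ x + r + L ≡ c + j + L
  x+r+L≡c+j+L = begin-equality
    position σ x + r + L    ≡⟨ +-assoc (position σ x) r L ⟩
    position σ x + (r + L)  ≡⟨ cong (position σ x +_) r+L≡m ⟩
    position σ x + m        ≡⟨ x+m≡p+j ⟩
    toℕ p + j               ≡⟨ cong (_+ j) p≡c+L ⟩
    c + L + j               ≡⟨ xy∙z≈xz∙y c L j ⟩
    c + j + L               ∎

MemberIntervalAt : ∀ {m} → Family m → Permutation′ m → ℕ → Fin m → Set
MemberIntervalAt F σ r p = ∃ λ S → F S × IsIntervalAt σ r p S

-- The intervals through the last position are the r ones starting at L, …, m - 1;
-- saturation forces all of them into F.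
saturated⇒intervals-through-last : ∀ {m} {F : Family m} (σ : Permutation′ m) {r L q} →
  r + L ≡ m → IsLastPos q → Saturated F r σ → AllContainLast F r σ →
  ∀ c → c < r → ∃ λ p → toℕ p ≡ c + L × MemberIntervalAt F σ r p
saturated⇒intervals-through-last {m} {F} σ {r} {L} {q} r+L≡m last (Ls , uniq , |Ls|≡r , Ls⊆Fσ , _) lastσ c c<r
  = hit (injective⇒surjective (≤-reflexive (sym |Ls|≡r)) offset-injective (fromℕ< c<r))
  where
  member : (i : Fin (length Ls)) → Fσ F σ r (lookup Ls i)
  member i = All.lookup Ls⊆Fσ (∈-lookup i)
  origin : Fin (length Ls) → Fin m
  origin i = proj₁ (proj₂ (member i))
  interval : ∀ i → IsIntervalAt σ r (origin i) (lookup Ls i)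
  interval i = proj₂ (proj₂ (member i))
  L≤origin : ∀ i → L ≤ toℕ (origin i)
  L≤origin i = +-cancelˡ-≤ r L _ (begin
    r + L              ≡⟨ r+L≡m ⟩
    m                  ≤⟨ last∈interval⇒m≤start+r σ (subst (r ≤_) r+L≡m (m≤m+n r L)) last (interval i)
                            (lastσ _ (member i) q last) ⟩
    toℕ (origin i) + r ≡⟨ +-comm (toℕ (origin i)) r ⟩
    r + toℕ (origin i) ∎)
    where open ≤-Reasoning
  offset<r : ∀ i → toℕ (origin i) ∸ L < r
  offset<r i = +-cancelʳ-< L _ r (subst₂ _<_ (sym (m∸n+n≡m (L≤origin i))) (sym r+L≡m) (toℕ<n (origin i)))
  offset : Fin (length Ls) → Fin r
  offset i = fromℕ< (offset<r i)
  offset-injective : Injective _≡_ _≡_ offset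
  offset-injective {i} {j} eq = lookup-injective uniq
    (IsIntervalAt-unique σ (subst (λ p → IsIntervalAt σ r p (lookup Ls i)) origin-i≡origin-j (interval i))
                           (interval j))
    where
    origin-i≡origin-j : origin i ≡ origin j
    origin-i≡origin-j = toℕ-injective (∸-cancelʳ-≡ (L≤origin i) (L≤origin j)
      (trans (sym (toℕ-fromℕ< (offset<r i))) (trans (cong toℕ eq) (toℕ-fromℕ< (offset<r j)))))
  hit : (∃ λ i → offset i ≡ fromℕ< c<r) → ∃ λ p → toℕ p ≡ c + L × MemberIntervalAt F σ r p
  hit (i , offset-i≡c) = origin i , origin-i≡c+L , lookup Ls i , proj₁ (member i) , interval i
    where
    origin-i≡c+L : toℕ (origin i) ≡ c + L
    origin-i≡c+L = trans (sym (m∸n+n≡m (L≤origin i)))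
      (cong (_+ L) (trans (sym (toℕ-fromℕ< (offset<r i))) (trans (cong toℕ offset-i≡c) (toℕ-fromℕ< c<r))))

data Step (Top : Pred ℕ 0ℓ) : ℕ → ℕ → Set where
  stay : ∀ {u} → Step Top u u
  down : ∀ {v} → Top (suc v) → Step Top (suc v) v
  up   : ∀ {u} → Top (suc u) → Step Top u (suc u)

Step-map : ∀ {P Q : Pred ℕ 0ℓ} → P ⊆ Q → ∀ {u v} → Step P u v → Step Q u v
Step-map f stay      = stay
Step-map f (down Pu) = down (f Pu)
Step-map f (up Pu+1) = up (f Pu+1)

transpose-adjacent-step : ∀ {m} {a b : Fin m} {t} → suc (toℕ a) ≡ t → toℕ b ≡ t →
                          ∀ x → Step (_≡ t) (toℕ x) (toℕ (PC.transpose a b x))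
transpose-adjacent-step {a = a} {b} 1+a≡t b≡t x with x Fin.≟ a
... | yes refl = subst (Step _ (toℕ a)) (trans 1+a≡t (sym b≡t)) (up 1+a≡t)
... | no _ with x Fin.≟ b
...   | yes refl = subst (λ w → Step _ w (toℕ a)) (trans 1+a≡t (sym b≡t)) (down 1+a≡t)
...   | no _     = stay

-- Two adjacent swaps compose to a single Step as long as they are at least two apart.
Step-∘ : ∀ {P Q : Pred ℕ 0ℓ} → (∀ {x y} → P x → Q y → x ≢ y × x ≢ suc y × suc x ≢ y) →
         ∀ {u w v} → Step P u w → Step Q w v → Step (P ∪ Q) u v
Step-∘ far stay       s          = Step-map inj₂ s
Step-∘ far s          stay       = Step-map inj₁ s
Step-∘ far (down Pu)  (down Qw)  = contradiction refl (proj₁ (proj₂ (far Pu Qw)))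
Step-∘ far (down Pu)  (up Qu)    = contradiction refl (proj₁ (far Pu Qu))
Step-∘ far (up Pu+1)  (down Qu+1) = contradiction refl (proj₁ (far Pu+1 Qu+1))
Step-∘ far (up Pu+1)  (up Qu+2)  = contradiction refl (proj₂ (proj₂ (far Pu+1 Qu+2)))

UpperEnd : ℕ → ℕ → Pred ℕ 0ℓ
UpperEnd i n = (_≡ i) ∪ (_≡ i + n)

swap-step : ∀ {m} (σ : Permutation′ m) {i n} {a b c d : Fin m} → 2 ≤ n →
  suc (toℕ a) ≡ i → toℕ b ≡ i → suc (toℕ c) ≡ i + n → toℕ d ≡ i + n →
  ∀ x → Step (UpperEnd i n) (position (swapOrdering σ a b c d) x) (position σ x)
swap-step σ {i} {n} {a} {b} {c} {d} 2≤n 1+a≡i b≡i 1+c≡i+n d≡i+n x =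
  subst (Step (UpperEnd i n) (toℕ q)) τq≡x
    (Step-∘ far (transpose-adjacent-step 1+a≡i b≡i q)
                (transpose-adjacent-step 1+c≡i+n d≡i+n (PC.transpose a b q)))
  where
  μ = swapOrdering σ a b c d
  q = μ ⟨$⟩ˡ x
  τq≡x : toℕ (PC.transpose c d (PC.transpose a b q)) ≡ position σ x
  τq≡x = trans (sym (position-⟨$⟩ʳ σ _)) (cong (position σ) (inverseʳ μ))
  far : ∀ {x y} → x ≡ i → y ≡ i + n → x ≢ y × x ≢ suc y × suc x ≢ y
  far refl refl = <⇒≢ (m<m+n i (≤-trans (s≤s z≤n) 2≤n)) , m≢1+m+n i ,
                  <⇒≢ (subst (_< i + n) (+-comm i 1) (+-monoʳ-< i 2≤n))

Step⇒pred≤ : ∀ {P u v} → Step P u v → pred u ≤ v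
Step⇒pred≤ stay     = pred[n]≤n
Step⇒pred≤ (down _) = ≤-refl
Step⇒pred≤ (up _)   = ≤-trans pred[n]≤n (n≤1+n _)

Step⇒≤suc : ∀ {P u v} → Step P u v → v ≤ suc u
Step⇒≤suc stay     = n≤1+n _
Step⇒≤suc (down _) = ≤-trans (n≤1+n _) (n≤1+n _)
Step⇒≤suc (up _)   = ≤-refl

Step-lower : ∀ {P : Pred ℕ 0ℓ} {p} → Dec (P p) →
  ∃ λ lo → lo ≤ p × (p ≤ lo ⊎ (p ≤ suc lo × P p)) × (∀ {u v} → p ≤ u → Step P u v → lo ≤ v)
Step-lower {p = p} (yes Pp) =
  pred p , pred[n]≤n , inj₂ (p≤suc-pred p , Pp) , λ p≤u s → ≤-trans (pred-mono-≤ p≤u) (Step⇒pred≤ s)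
  where
  p≤suc-pred : ∀ p → p ≤ suc (pred p)
  p≤suc-pred zero    = z≤n
  p≤suc-pred (suc p) = ≤-refl
Step-lower {P} {p} (no ¬Pp) = p , ≤-refl , inj₁ ≤-refl , bound
  where
  bound : ∀ {u v} → p ≤ u → Step P u v → p ≤ v
  bound p≤u stay       = p≤u
  bound p≤u (down Pu)  with m≤n⇒m<n∨m≡n p≤u
  ... | inj₁ p<u  = s≤s⁻¹ p<u
  ... | inj₂ refl = contradiction Pu ¬Pp
  bound p≤u (up _)     = ≤-trans p≤u (n≤1+n _)

Step-upper : ∀ {P : Pred ℕ 0ℓ} {e} → Dec (P e) →
  ∃ λ hi → (hi ≤ e ⊎ (hi ≤ suc e × P e)) × (∀ {u v} → u < e → Step P u v → v < hi)
Step-upper {e = e} (yes Pe) = suc e , inj₂ (≤-refl , Pe) , λ u<e s → s≤s (≤-trans (Step⇒≤suc s) u<e)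
Step-upper {P} {e} (no ¬Pe) = e , inj₁ ≤-refl , bound
  where
  bound : ∀ {u v} → u < e → Step P u v → v < e
  bound u<e stay       = u<e
  bound u<e (down _)   = <-trans (n<1+n _) u<e
  bound u<e (up Pu+1)  with m≤n⇒m<n∨m≡n u<e
  ... | inj₁ u+1<e = u+1<e
  ... | inj₂ refl  = contradiction Pu+1 ¬Pe

window-width : ∀ {P : Pred ℕ 0ℓ} {p r lo hi W} → p ≤ lo ⊎ (p ≤ suc lo × P p) →
  hi ≤ p + r ⊎ (hi ≤ suc (p + r) × P (p + r)) → r < W → (P p → P (p + r) → r + 2 ≤ W) → hi ≤ lo + W
window-width {p = p} {r} {lo} {hi} {W} (inj₁ p≤lo) (inj₁ hi≤e) r<W _ = begin
  hi      ≤⟨ hi≤e ⟩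
  p + r   ≤⟨ +-mono-≤ p≤lo (<⇒≤ r<W) ⟩
  lo + W  ∎
  where open ≤-Reasoning
window-width {p = p} {r} {lo} {hi} {W} (inj₁ p≤lo) (inj₂ (hi≤e+1 , _)) r<W _ = begin
  hi            ≤⟨ hi≤e+1 ⟩
  suc (p + r)   ≡⟨ sym (+-suc p r) ⟩
  p + suc r     ≤⟨ +-mono-≤ p≤lo r<W ⟩
  lo + W        ∎
  where open ≤-Reasoning
window-width {p = p} {r} {lo} {hi} {W} (inj₂ (p≤lo+1 , _)) (inj₁ hi≤e) r<W _ = begin
  hi            ≤⟨ hi≤e ⟩
  p + r         ≤⟨ +-monoˡ-≤ r p≤lo+1 ⟩
  suc lo + r    ≡⟨ sym (+-suc lo r) ⟩
  lo + suc r    ≤⟨ +-monoʳ-≤ lo r<W ⟩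
  lo + W        ∎
  where open ≤-Reasoning
window-width {p = p} {r} {lo} {hi} {W} (inj₂ (p≤lo+1 , Pp)) (inj₂ (hi≤e+1 , Pe)) _ wide = begin
  hi                ≤⟨ hi≤e+1 ⟩
  suc (p + r)       ≤⟨ s≤s (+-monoˡ-≤ r p≤lo+1) ⟩
  suc (suc lo + r)  ≡⟨ cong suc (sym (+-suc lo r)) ⟩
  suc (lo + suc r)  ≡⟨ sym (+-suc lo (suc r)) ⟩
  lo + suc (suc r)  ≡⟨ cong (lo +_) (+-comm 2 r) ⟩
  lo + (r + 2)      ≤⟨ +-monoʳ-≤ lo (wide Pp Pe) ⟩
  lo + W            ∎
  where open ≤-Reasoning

-- Gaps [c, c + L) laid end to end from lo; capping c at r - 1 keeps each one the gap of an
-- interval through the last position.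
gapStart : ℕ → ℕ → ℕ → ℕ → ℕ
gapStart lo L r t = (lo + t * L) ⊓ pred r

gap-cover : ∀ {lo hi r L K v} .{{_ : NonZero L}} → lo < r → hi < r + L → hi ≤ lo + K * L →
  lo ≤ v → v < hi → ∃ λ (t : Fin K) → gapStart lo L r (toℕ t) ≤ v × v < gapStart lo L r (toℕ t) + L
gap-cover {lo} {hi} {r} {L} {K} {v} lo<r hi<r+L hi≤lo+KL lo≤v v<hi =
  fromℕ< t<K , subst (λ s → gapStart lo L r s ≤ v × v < gapStart lo L r s + L) (sym (toℕ-fromℕ< t<K))
                     (start≤v , v<end)
  where
  open ≤-Reasoning
  d = v ∸ lo
  t = d / L
  v≡lo+d : v ≡ lo + d
  v≡lo+d = sym (m+[n∸m]≡n lo≤v)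
  t<K : t < K
  t<K = m<n*o⇒m/o<n (+-cancelˡ-< lo d (K * L) (subst (_< lo + K * L) v≡lo+d (<-≤-trans v<hi hi≤lo+KL)))
  start≤v : gapStart lo L r t ≤ v
  start≤v = begin
    (lo + t * L) ⊓ pred r ≤⟨ m⊓n≤m _ _ ⟩
    lo + t * L            ≤⟨ +-monoʳ-≤ lo (m/n*n≤m d L) ⟩
    lo + d                ≡⟨ sym v≡lo+d ⟩
    v                     ∎
  d<t*L+L : d < t * L + L
  d<t*L+L = begin-strict
    d             ≡⟨ m≡m%n+[m/n]*n d L ⟩
    d % L + t * L <⟨ +-monoˡ-< (t * L) (m%n<n d L) ⟩
    L + t * L     ≡⟨ +-comm L (t * L) ⟩
    t * L + L     ∎
  v<lo+t*L+L : v < lo + t * L + L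
  v<lo+t*L+L = begin-strict
    v                  ≡⟨ v≡lo+d ⟩
    lo + d             <⟨ +-monoʳ-< lo d<t*L+L ⟩
    lo + (t * L + L)   ≡⟨ sym (+-assoc lo (t * L) L) ⟩
    lo + t * L + L     ∎
  v<pred-r+L : v < pred r + L
  v<pred-r+L = <-≤-trans v<hi (s≤s⁻¹ (begin
    suc hi             ≤⟨ hi<r+L ⟩
    r + L              ≡⟨ cong (_+ L) (sym (suc-pred r {{>-nonZero (≤-<-trans z≤n lo<r)}})) ⟩
    suc (pred r) + L   ∎))
  v<end : v < gapStart lo L r t + L
  v<end = subst (v <_) (sym (+-distribʳ-⊓ L (lo + t * L) (pred r))) (⊓-glb v<lo+t*L+L v<pred-r+L)

short-window⇒¬intersecting : ∀ {m} {F : Family m} (σ : Permutation′ m) {r L K lo hi T} →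
  r + L ≡ m → KWiseIntersecting (suc K) F →
  (∀ c → c < r → ∃ λ p → toℕ p ≡ c + L × MemberIntervalAt F σ r p) →
  F T → lo < r → hi < m → hi ≤ lo + K * L →
  (∀ {x} → x ∈ T → lo ≤ position σ x × position σ x < hi) → ⊥
short-window⇒¬intersecting {m} {F} σ {suc r′} {L} {K} {lo} {hi} {T}
  r+L≡m intersecting through-last T∈F lo<r hi<m hi≤lo+KL T-window =
  x∉gap (gap-cover {K = K} {{L≢0}} lo<r (subst (hi <_) (sym r+L≡m) hi<m) hi≤lo+KL lo≤v v<hi)
  where
  c : ℕ → ℕ
  c = gapStart lo L (suc r′)
  gapInterval : ∀ t → ∃ λ p → toℕ p ≡ c t + L × MemberIntervalAt F σ (suc r′) p
  gapInterval t = through-last (c t) (s≤s (m⊓n≤n _ _))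
  origin≡ : ∀ t → toℕ (proj₁ (gapInterval t)) ≡ c t + L
  origin≡ t = proj₁ (proj₂ (gapInterval t))
  interval : ∀ t → IsIntervalAt σ (suc r′) (proj₁ (gapInterval t)) (proj₁ (proj₂ (proj₂ (gapInterval t))))
  interval t = proj₂ (proj₂ (proj₂ (proj₂ (gapInterval t))))
  A : Fin (suc K) → Subset m
  A Fin.zero    = T
  A (Fin.suc t) = proj₁ (proj₂ (proj₂ (gapInterval (toℕ t))))
  A∈F : ∀ j → F (A j)
  A∈F Fin.zero    = T∈F
  A∈F (Fin.suc t) = proj₁ (proj₂ (proj₂ (proj₂ (gapInterval (toℕ t)))))
  x = proj₁ (intersecting A A∈F)
  x∈A : ∀ j → x ∈ A j
  x∈A = proj₂ (intersecting A A∈F)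
  lo≤v = proj₁ (T-window (x∈A Fin.zero))
  v<hi = proj₂ (T-window (x∈A Fin.zero))
  L≢0 : NonZero L
  L≢0 = m*n≢0⇒n≢0 K {{>-nonZero (+-cancelˡ-< lo 0 (K * L)
    (subst (_< lo + K * L) (sym (+-identityʳ lo)) (≤-<-trans lo≤v (<-≤-trans v<hi hi≤lo+KL))))}}
  x∉gap : ¬ ∃ λ (t : Fin K) → c (toℕ t) ≤ position σ x × position σ x < c (toℕ t) + L
  x∉gap (t , c≤v , v<c+L)
    with wrapping-interval⇒position σ r+L≡m (origin≡ (toℕ t)) (interval (toℕ t)) (x∈A (Fin.suc t))
  ... | inj₁ v<c   = <⇒≱ v<c c≤v
  ... | inj₂ c+L≤v = <⇒≱ v<c+L c+L≤v

UpperEnd? : ∀ i n u → Dec (UpperEnd i n u)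
UpperEnd? i n u = (u ≟ i) ⊎-dec (u ≟ i + n)

UpperEnd-apart : ∀ {i n p r} → 0 < r → UpperEnd i n p → UpperEnd i n (p + r) → r ≡ n
UpperEnd-apart {i}         0<r (inj₁ refl) (inj₁ i+r≡i)     = contradiction (sym i+r≡i) (<⇒≢ (m<m+n i 0<r))
UpperEnd-apart {i} {n} {r = r} _ (inj₁ refl) (inj₂ i+r≡i+n) = +-cancelˡ-≡ i r n i+r≡i+n
UpperEnd-apart {i} {n}     0<r (inj₂ refl) (inj₁ i+n+r≡i)   =
  contradiction (sym i+n+r≡i) (<⇒≢ (≤-<-trans (m≤m+n i n) (m<m+n (i + n) 0<r)))
UpperEnd-apart {i} {n}     0<r (inj₂ refl) (inj₂ i+n+r≡i+n) =
  contradiction (sym i+n+r≡i+n) (<⇒≢ (m<m+n (i + n) 0<r))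

UpperEnd-< : ∀ {i n u} → i + 2 ≤ n → UpperEnd i n u → suc u < n + n
UpperEnd-< {i} {n} i+2≤n (inj₁ refl) = ≤-trans (subst (_≤ n) (+-comm i 2) i+2≤n) (m≤m+n n n)
UpperEnd-< {i} {n} i+2≤n (inj₂ refl) = begin
  suc (suc (i + n)) ≡⟨ cong suc (sym (+-suc i n)) ⟩
  suc (i + suc n)   ≡⟨ sym (+-suc i (suc n)) ⟩
  i + (2 + n)       ≡⟨ sym (+-assoc i 2 n) ⟩
  i + 2 + n         ≤⟨ +-monoˡ-≤ n i+2≤n ⟩
  n + n             ∎
  where open ≤-Reasoning

complement-length : ∀ {K n r} → suc K * r < K * (n + n) → ∃ λ L → r + L ≡ n + n × r < K * L
complement-length {K} {n} {r} ineq with r ≤? n + n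
... | no r≰2n = contradiction ineq (≤⇒≯ (≤-trans (*-monoʳ-≤ K (<⇒≤ (≰⇒> r≰2n))) (m≤n+m (K * r) r)))
... | yes r≤2n = n + n ∸ r , r+L≡2n , +-cancelʳ-< (K * r) r (K * L) (begin-strict
  r + K * r          <⟨ ineq ⟩
  K * (n + n)        ≡⟨ cong (K *_) (sym r+L≡2n) ⟩
  K * (r + L)        ≡⟨ *-distribˡ-+ K r L ⟩
  K * r + K * L      ≡⟨ +-comm (K * r) (K * L) ⟩
  K * L + K * r      ∎)
  where
  open ≤-Reasoning
  L = n + n ∸ r
  r+L≡2n : r + L ≡ n + n
  r+L≡2n = m+[n∸m]≡n r≤2n

n<k*n⇒n+n≤k*n : ∀ {k n} → n < k * n → n + n ≤ k * n
n<k*n⇒n+n≤k*n {1} {n} n<n+0 = contradiction (subst (n <_) (+-identityʳ n) n<n+0) (<-irrefl refl)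
n<k*n⇒n+n≤k*n {suc (suc k)} {n} _ = +-monoʳ-≤ n (m≤m+n n (k * n))

swapped-interval⇒short-window : ∀ {n} (σ : Permutation′ (n + n)) {r L K i p T} {a b c d : Fin (n + n)} →
  r + L ≡ n + n → n ≤ r → r < K * L → i + 2 ≤ n →
  suc (toℕ a) ≡ i → toℕ b ≡ i → suc (toℕ c) ≡ i + n → toℕ d ≡ i + n →
  IsIntervalAt (swapOrdering σ a b c d) r p T → toℕ p + r < n + n →
  ∃ λ lo → ∃ λ hi → lo < r × hi < n + n × hi ≤ lo + K * L ×
    (∀ {x} → x ∈ T → lo ≤ position σ x × position σ x < hi)
swapped-interval⇒short-window {n} σ {r} {L} {K} {i} {p} {T} {a} {b} {c} {d}
  r+L≡2n n≤r r<KL i+2≤n 1+a≡i b≡i 1+c≡i+n d≡i+n T-at-p p+r<2n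
  with Step-lower (UpperEnd? i n (toℕ p)) | Step-upper (UpperEnd? i n (toℕ p + r))
... | lo , lo≤p , p≤lo⁺ , lower | hi , hi≤e⁺ , upper =
  lo , hi , lo<r , hi<2n hi≤e⁺ , window-width {P = UpperEnd i n} p≤lo⁺ hi≤e⁺ r<KL wide , window
  where
  2≤n : 2 ≤ n
  2≤n = ≤-trans (m≤n+m 2 i) i+2≤n
  L≤r : L ≤ r
  L≤r = +-cancelˡ-≤ r L r (subst (_≤ r + r) (sym r+L≡2n) (+-mono-≤ n≤r n≤r))
  lo<r : lo < r
  lo<r = ≤-<-trans lo≤p (<-≤-trans p<L L≤r)
    where p<L = +-cancelˡ-< r (toℕ p) L (subst₂ _<_ (+-comm (toℕ p) r) (sym r+L≡2n) p+r<2n)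
  hi<2n : hi ≤ toℕ p + r ⊎ (hi ≤ suc (toℕ p + r) × UpperEnd i n (toℕ p + r)) → hi < n + n
  hi<2n (inj₁ hi≤e)             = ≤-<-trans hi≤e p+r<2n
  hi<2n (inj₂ (hi≤e+1 , e-end)) = ≤-<-trans hi≤e+1 (UpperEnd-< i+2≤n e-end)
  -- Both ends of the window can only widen when r = n, and then L = n as well.
  wide : UpperEnd i n (toℕ p) → UpperEnd i n (toℕ p + r) → r + 2 ≤ K * L
  wide p-end e-end with UpperEnd-apart (≤-trans (≤-trans (s≤s z≤n) 2≤n) n≤r) p-end e-end
  ... | refl with +-cancelˡ-≡ n L n r+L≡2n
  ...   | refl = ≤-trans (+-monoʳ-≤ n 2≤n) (n<k*n⇒n+n≤k*n {K} r<KL)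
  window : ∀ {x} → x ∈ T → lo ≤ position σ x × position σ x < hi
  window {x} x∈T with non-wrapping-interval⇒position (swapOrdering σ a b c d) (<⇒≤ p+r<2n) T-at-p x∈T
  ... | p≤u , u<e = lower p≤u step , upper u<e step
    where step = swap-step σ 2≤n 1+a≡i b≡i 1+c≡i+n d≡i+n x

lemma3p1 : (k n r : ℕ) → 2 ≤ k → n ≤ r → k * r < (k ∸ 1) * (n + n) →
    (F : Family (n + n)) → FamilyInH n r F → KWiseIntersecting k F →
    (σ : Permutation′ (n + n)) → Good n σ → Saturated F r σ → AllContainLast F r σ →
    (i : ℕ) → 1 ≤ i → i + 2 ≤ n →
    (a b c d : Fin (n + n)) →
    suc (toℕ a) ≡ i → toℕ b ≡ i → suc (toℕ c) ≡ i + n → toℕ d ≡ i + n →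
    Saturated F r (swapOrdering σ a b c d) →
    AllContainLast F r (swapOrdering σ a b c d)
lemma3p1 (suc K) n r _ n≤r ineq F _ intersecting σ _ saturated lastσ i _ i+2≤n
         a b c d 1+a≡i b≡i 1+c≡i+n d≡i+n _
         T (T∈F , p , T-at-p) q last
  with complement-length {K} {n} {r} ineq | swapOrdering σ a b c d ⟨$⟩ʳ q ∈? T
... | _ | yes last∈T = last∈T
... | L , r+L≡2n , r<KL | no last∉T
  with swapped-interval⇒short-window σ {r} {L} {K} r+L≡2n n≤r r<KL i+2≤n 1+a≡i b≡i 1+c≡i+n d≡i+n T-at-p
         (last∉interval⇒start+r<m (swapOrdering σ a b c d) last T-at-p last∉T)
... | lo , hi , lo<r , hi<2n , hi≤lo+KL , window =
  ⊥-elim (short-window⇒¬intersecting σ {r} {L} {K} r+L≡2n intersecting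
    (saturated⇒intervals-through-last σ {r} {L} r+L≡2n last saturated lastσ) T∈F lo<r hi<2n hi≤lo+KL window)
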